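{- Let $G=(V,E)$ be a graph, let $\pi$ be a uniformly random permutation of $V$, and let $E_+$ (edges to insert) and $E_-$ (edges to delete) be sets of edges on $V$, fixed independently of $\pi$, with $|E_+|+|E_-|=b$. Let $G_{\mathrm{new}}=(V,(E\cup E_+)\setminus E_-)$. Then $\mathbb{E}_\pi\big[|M(G)\,\triangle\, M(G_{\mathrm{new}})|\big]\le b$, i.e., the expected recourse of the R-LFMIS for a set of $b$ edge updates is at most $b$.
   Context: For a graph $H$ on vertex set $V$ and ordering $\pi$ of $V$, $M(H)$ denotes the lexicographically first maximal independent set: scan vertices in $\pi$-order and add a vertex iff none of its neighbors has already been added. $\triangle$ denotes symmetric difference. -}

module Defs where

open import Data.Bool using (Bool; true; false; _∧_; _∨_; not; _xor_; if_then_else_)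
open import Data.Nat using (ℕ; zero; suc; _+_; _*_; _<ᵇ_)
open import Data.Fin using (Fin; toℕ; _≟_)
open import Data.List using (List; []; _∷_; map; concatMap; allFin)
open import Data.Nat.ListAction using (sum)
open import Data.Bool.ListAction using (any)
open import Relation.Binary.PropositionalEquality using (_≡_)
open import Relation.Nullary.Decidable using (⌊_⌋)

Rel : ℕ → Set
Rel n = Fin n → Fin n → Bool

record IsSimple {n : ℕ} (A : Rel n) : Set where
  field
    symmetric   : ∀ i j → A i j ≡ A j i
    irreflexive : ∀ i → A i i ≡ false

b2n : Bool → ℕ
b2n true  = 1
b2n false = 0

edgeCount : {n : ℕ} → Rel n → ℕ
edgeCount {n} A =
  sum (map (λ i → sum (map (λ j → b2n ((toℕ i <ᵇ toℕ j) ∧ A i j)) (allFin n))) (allFin n))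

update : {n : ℕ} → Rel n → Rel n → Rel n → Rel n
update E E₊ E₋ i j = (E i j ∨ E₊ i j) ∧ not (E₋ i j)

insertEverywhere : {A : Set} → A → List A → List (List A)
insertEverywhere x []       = (x ∷ []) ∷ []
insertEverywhere x (y ∷ ys) = (x ∷ y ∷ ys) ∷ map (y ∷_) (insertEverywhere x ys)

permutations : {A : Set} → List A → List (List A)
permutations []       = [] ∷ []
permutations (x ∷ xs) = concatMap (insertEverywhere x) (permutations xs)

orderings : (n : ℕ) → List (List (Fin n))
orderings n = permutations (allFin n)

lfmisGo : {n : ℕ} → Rel n → List (Fin n) → List (Fin n) → List (Fin n)
lfmisGo H chosen []       = chosen
lfmisGo H chosen (v ∷ vs) =
  if any (H v) chosen then lfmisGo H chosen vs else lfmisGo H (v ∷ chosen) vs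

lfmis : {n : ℕ} → Rel n → List (Fin n) → List (Fin n)
lfmis H π = lfmisGo H [] π

memb : {n : ℕ} → Fin n → List (Fin n) → Bool
memb v xs = any (λ u → ⌊ u ≟ v ⌋) xs

symDiffSize : {n : ℕ} → Rel n → Rel n → List (Fin n) → ℕ
symDiffSize {n} G G' π =
  sum (map (λ v → b2n (memb v (lfmis G π) xor memb v (lfmis G' π))) (allFin n))

-- Sum over all n! orderings (= n! · E_π[·] for uniform π).
sumOverOrderings : (n : ℕ) → (List (Fin n) → ℕ) → ℕ
sumOverOrderings n f = sum (map f (orderings n))

{-# OPTIONS --safe #-}
-- Run the greedy scans for G and G_new along the same ordering. While C and C' are the sets chosen
-- so far and L is the list of unscanned vertices, consider the potential
--   2·|C △ C'| + 2·#{y ∈ L available in exactly one scan} + #{(x , y) ∈ L² : xy ∈ E(G) △ E(G_new)}.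
-- Drawing the next vertex x uniformly from L does not increase it in expectation: x enlarges
-- C △ C' only if it was available in exactly one scan, and it can change the availability mismatch
-- of another vertex y only across the edge xy; if that edge differs, the pairs (x , y) and (y , x)
-- leave the last term, otherwise the changes at y and, for the opposite order, at x are paid by
-- the old mismatches at x and y. At the end the potential is 2·|M(G) △ M(G_new)|; at the start it
-- is 2·|E(G) △ E(G_new)| ≤ 2b.
module Submission where

open import Defs
open import Data.Nat using (ℕ; _+_; _*_; _≤_)
open import Data.Nat using (_!)
open import Relation.Binary.PropositionalEquality using (_≡_)

open import Data.Bool using (Bool; true; false; _∧_; _∨_; not; _xor_; if_then_else_; T)
open import Data.Bool.ListAction using (any)
open import Data.Bool.Properties using (∧-zeroʳ; ∧-identityʳ; ∨-∧-booleanAlgebra)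
open import Data.Fin using (Fin; zero; suc; toℕ; _≟_)
open import Data.Fin.Properties using (toℕ-injective)
open import Data.List using (List; []; _∷_; _++_; map; concatMap; length; allFin)
open import Data.List.Membership.Propositional using (_∈_)
open import Data.List.Membership.Propositional.Properties using (∈-map⁻)
open import Data.List.Properties using (map-++; map-∘; map-cong; map-tabulate; length-tabulate)
open import Data.List.Relation.Binary.Permutation.Propositional using (_↭_; ↭-refl; ↭-prep; ↭-swap; ↭-trans)
open import Data.List.Relation.Binary.Permutation.Propositional.Properties using (map⁺; ↭-length)
open import Data.List.Relation.Unary.Any using (here; there)
open import Data.Nat using (zero; suc; z≤n; s≤s; _<ᵇ_)
open import Data.Nat.ListAction using (sum)
open import Data.Nat.ListAction.Properties using (sum-++; sum-↭)
open import Data.Nat.Properties hiding (_≟_)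
open import Data.Nat.Tactic.RingSolver using (solve-∀)
open import Data.Product using (_×_; _,_; proj₁; proj₂; map₂)
open import Function using (_∘_; id)
open import Relation.Binary.PropositionalEquality using (refl; sym; trans; cong; cong₂; subst; module ≡-Reasoning)
open import Relation.Nullary using (contradiction)
open import Relation.Nullary.Decidable using (⌊_⌋; ⌊⌋-map′)
open import Algebra.Lattice.Properties.BooleanAlgebra ∨-∧-booleanAlgebra using (deMorgan₂)
open import Algebra.Properties.CommutativeSemigroup +-commutativeSemigroup using (interchange)

∑ : {A : Set} → (A → ℕ) → List A → ℕ
∑ f xs = sum (map f xs)

syntax ∑ (λ x → e) xs = ∑[ x ∈ xs ] e

module _ {A : Set} where

  ∑-cong : ∀ {f g : A → ℕ} xs → (∀ x → f x ≡ g x) → ∑ f xs ≡ ∑ g xs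
  ∑-cong xs f≗g = cong sum (map-cong f≗g xs)

  ∑-mono-≤ : ∀ {f g : A → ℕ} xs → (∀ {x} → x ∈ xs → f x ≤ g x) → ∑ f xs ≤ ∑ g xs
  ∑-mono-≤ []       f≤g = z≤n
  ∑-mono-≤ (x ∷ xs) f≤g = +-mono-≤ (f≤g (here refl)) (∑-mono-≤ xs (f≤g ∘ there))

  ∑-++ : ∀ (f : A → ℕ) xs ys → ∑ f (xs ++ ys) ≡ ∑ f xs + ∑ f ys
  ∑-++ f xs ys = trans (cong sum (map-++ f xs ys)) (sum-++ (map f xs) (map f ys))

  ∑-↭ : ∀ (f : A → ℕ) {xs ys} → xs ↭ ys → ∑ f xs ≡ ∑ f ys
  ∑-↭ f xs↭ys = sum-↭ (map⁺ f xs↭ys)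

  ∑-distrib-+ : ∀ (f g : A → ℕ) xs → ∑[ x ∈ xs ] (f x + g x) ≡ ∑ f xs + ∑ g xs
  ∑-distrib-+ f g []       = refl
  ∑-distrib-+ f g (x ∷ xs) =
    trans (cong (f x + g x +_) (∑-distrib-+ f g xs)) (interchange (f x) (g x) (∑ f xs) (∑ g xs))

  *-distribˡ-∑ : ∀ c (f : A → ℕ) xs → c * ∑ f xs ≡ ∑[ x ∈ xs ] (c * f x)
  *-distribˡ-∑ c f []       = *-zeroʳ c
  *-distribˡ-∑ c f (x ∷ xs) = trans (*-distribˡ-+ c (f x) (∑ f xs)) (cong (c * f x +_) (*-distribˡ-∑ c f xs))

  ∑-const : ∀ c (xs : List A) → ∑ (λ _ → c) xs ≡ length xs * c
  ∑-const c []       = refl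
  ∑-const c (x ∷ xs) = cong (c +_) (∑-const c xs)

  ∑-zero : ∀ (xs : List A) → ∑ (λ _ → 0) xs ≡ 0
  ∑-zero xs = trans (∑-const 0 xs) (*-zeroʳ (length xs))

module _ {A B : Set} where

  ∑-map : ∀ (f : B → ℕ) (g : A → B) xs → ∑ f (map g xs) ≡ ∑ (f ∘ g) xs
  ∑-map f g xs = cong sum (sym (map-∘ xs))

  ∑-concatMap : ∀ (f : B → ℕ) (g : A → List B) xs → ∑ f (concatMap g xs) ≡ ∑[ x ∈ xs ] ∑ f (g x)
  ∑-concatMap f g []       = refl
  ∑-concatMap f g (x ∷ xs) =
    trans (∑-++ f (g x) (concatMap g xs)) (cong (∑ f (g x) +_) (∑-concatMap f g xs))

  ∑-comm : ∀ (F : A → B → ℕ) xs ys → ∑[ x ∈ xs ] ∑[ y ∈ ys ] F x y ≡ ∑[ y ∈ ys ] ∑[ x ∈ xs ] F x y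
  ∑-comm F []       ys = sym (∑-zero ys)
  ∑-comm F (x ∷ xs) ys =
    trans (cong (∑ (F x) ys +_) (∑-comm F xs ys)) (sym (∑-distrib-+ (F x) _ ys))

  ∑∑-distrib-+ : ∀ (F G : A → B → ℕ) xs ys →
    ∑[ x ∈ xs ] ∑[ y ∈ ys ] (F x y + G x y) ≡ ∑[ x ∈ xs ] ∑[ y ∈ ys ] F x y + ∑[ x ∈ xs ] ∑[ y ∈ ys ] G x y
  ∑∑-distrib-+ F G xs ys = trans (∑-cong xs (λ x → ∑-distrib-+ (F x) (G x) ys)) (∑-distrib-+ _ _ xs)

module _ {A : Set} where

  ∑∑-symmetrise : ∀ (F : A → A → ℕ) xs →
    2 * ∑[ x ∈ xs ] ∑[ y ∈ xs ] F x y ≡ ∑[ x ∈ xs ] ∑[ y ∈ xs ] (F x y + F y x)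
  ∑∑-symmetrise F xs = begin
    2 * S                                   ≡⟨ cong (S +_) (+-identityʳ S) ⟩
    S + S                                   ≡⟨ cong (S +_) (∑-comm F xs xs) ⟩
    S + ∑[ x ∈ xs ] ∑[ y ∈ xs ] F y x       ≡⟨ sym (∑∑-distrib-+ F (λ x y → F y x) xs xs) ⟩
    ∑[ x ∈ xs ] ∑[ y ∈ xs ] (F x y + F y x) ∎
    where
    open ≡-Reasoning
    S = ∑[ x ∈ xs ] ∑[ y ∈ xs ] F x y

  ∑∑-mono-≤-symmetrised : ∀ {F G : A → A → ℕ} xs → (∀ x y → F x y + F y x ≤ G x y + G y x) →
    ∑[ x ∈ xs ] ∑[ y ∈ xs ] F x y ≤ ∑[ x ∈ xs ] ∑[ y ∈ xs ] G x y
  ∑∑-mono-≤-symmetrised {F} {G} xs F≤G = *-cancelˡ-≤ 2 (begin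
    2 * ∑[ x ∈ xs ] ∑[ y ∈ xs ] F x y       ≡⟨ ∑∑-symmetrise F xs ⟩
    ∑[ x ∈ xs ] ∑[ y ∈ xs ] (F x y + F y x) ≤⟨ ∑-mono-≤ xs (λ {x} _ → ∑-mono-≤ xs (λ {y} _ → F≤G x y)) ⟩
    ∑[ x ∈ xs ] ∑[ y ∈ xs ] (G x y + G y x) ≡⟨ sym (∑∑-symmetrise G xs) ⟩
    2 * ∑[ x ∈ xs ] ∑[ y ∈ xs ] G x y       ∎)
    where open ≤-Reasoning

  ∑∑-remove : ∀ {F : A → A → ℕ} → (∀ x y → F x y ≡ F y x) → (∀ x → F x x ≡ 0) →
    ∀ {x r xs} → x ∷ r ↭ xs →
    ∑[ a ∈ xs ] ∑[ b ∈ xs ] F a b ≡ ∑[ a ∈ r ] ∑[ b ∈ r ] F a b + 2 * ∑ (F x) xs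
  ∑∑-remove {F} F-sym F-diag {x} {r} {xs} x∷r↭xs = begin
    ∑[ a ∈ xs ] ∑[ b ∈ xs ] F a b             ≡⟨ sym (∑-↭ (λ a → ∑ (F a) xs) x∷r↭xs) ⟩
    row + ∑[ a ∈ r ] ∑[ b ∈ xs ] F a b        ≡⟨ cong (row +_) (∑-cong r (λ a → sym (∑-↭ (F a) x∷r↭xs))) ⟩
    row + ∑[ a ∈ r ] (F a x + ∑ (F a) r)      ≡⟨ cong (row +_) (∑-distrib-+ (λ a → F a x) _ r) ⟩
    row + (∑[ a ∈ r ] F a x + rest)           ≡⟨ cong (λ s → row + (s + rest)) column ⟩
    row + (row + rest)                        ≡⟨ regroup row rest ⟩
    rest + 2 * row                            ∎
    where
    open ≡-Reasoning
    row  = ∑ (F x) xs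
    rest = ∑[ a ∈ r ] ∑[ b ∈ r ] F a b
    column : ∑[ a ∈ r ] F a x ≡ row
    column = begin
      ∑[ a ∈ r ] F a x      ≡⟨ ∑-cong r (λ a → F-sym a x) ⟩
      ∑ (F x) r             ≡⟨ cong (_+ ∑ (F x) r) (sym (F-diag x)) ⟩
      ∑ (F x) (x ∷ r)       ≡⟨ ∑-↭ (F x) x∷r↭xs ⟩
      row                   ∎
    regroup : ∀ a b → a + (a + b) ≡ b + 2 * a
    regroup = solve-∀

∑-allFin-suc : ∀ {n} (f : Fin (suc n) → ℕ) → ∑ f (allFin (suc n)) ≡ f zero + ∑ (f ∘ suc) (allFin n)
∑-allFin-suc {n} f =
  cong (f zero +_) (trans (cong sum (map-tabulate suc f)) (sym (cong sum (map-tabulate id (f ∘ suc)))))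

∑-indicator : ∀ {n} (x : Fin n) c → ∑[ v ∈ allFin n ] b2n (⌊ x ≟ v ⌋ ∧ c) ≡ b2n c
∑-indicator {suc n} zero    c =
  trans (∑-allFin-suc {n} (λ v → b2n (⌊ zero ≟ v ⌋ ∧ c)))
        (trans (cong (b2n c +_) (∑-zero (allFin n))) (+-identityʳ (b2n c)))
∑-indicator {suc n} (suc x) c =
  trans (∑-allFin-suc {n} (λ v → b2n (⌊ suc x ≟ v ⌋ ∧ c)))
        (trans (∑-cong (allFin n) (λ v → cong (λ e → b2n (e ∧ c)) (⌊⌋-map′ _ _ (x ≟ v))))
               (∑-indicator x c))

-- Orderings grouped by their first vertex

select : {A : Set} → List A → List (A × List A)
select []       = []
select (x ∷ xs) = (x , xs) ∷ map (map₂ (x ∷_)) (select xs)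

module _ {A : Set} where

  select-↭ : ∀ {x : A} {r} xs → (x , r) ∈ select xs → x ∷ r ↭ xs
  select-↭ (y ∷ ys) (here refl) = ↭-refl
  select-↭ (y ∷ ys) (there p) with ∈-map⁻ (map₂ (y ∷_)) p
  ... | (z , r) , q , refl = ↭-trans (↭-swap z y ↭-refl) (↭-prep y (select-↭ ys q))

  ∑-select : ∀ (g : A → ℕ) xs → ∑[ p ∈ select xs ] g (proj₁ p) ≡ ∑ g xs
  ∑-select g []       = refl
  ∑-select g (x ∷ xs) = cong (g x +_) (trans (∑-map (g ∘ proj₁) (map₂ (x ∷_)) (select xs)) (∑-select g xs))

  -- Inserting x into an ordering of y ∷ ys either puts x first or keeps the first vertex of that ordering.
  ∑-permutations : ∀ (f : List A → ℕ) x xs →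
    ∑ f (permutations (x ∷ xs)) ≡ ∑[ p ∈ select (x ∷ xs) ] ∑[ τ ∈ permutations (proj₂ p) ] f (proj₁ p ∷ τ)
  ∑-permutations f x []       = cong (_+ 0) (sym (+-identityʳ (f (x ∷ []))))
  ∑-permutations f x (y ∷ ys) = begin
    ∑ f (concatMap (insertEverywhere x) (permutations (y ∷ ys)))
      ≡⟨ ∑-concatMap f (insertEverywhere x) (permutations (y ∷ ys)) ⟩
    ∑ g (permutations (y ∷ ys))
      ≡⟨ ∑-permutations g y ys ⟩
    ∑[ p ∈ S ] ∑[ τ ∈ permutations (proj₂ p) ] g (proj₁ p ∷ τ)
      ≡⟨ ∑-cong S (λ p → ∑-distrib-+ _ _ (permutations (proj₂ p))) ⟩
    ∑[ p ∈ S ] (∑[ τ ∈ permutations (proj₂ p) ] f (x ∷ proj₁ p ∷ τ) + later p)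
      ≡⟨ ∑-distrib-+ _ later S ⟩
    ∑[ p ∈ S ] ∑[ τ ∈ permutations (proj₂ p) ] f (x ∷ proj₁ p ∷ τ) + ∑ later S
      ≡⟨ cong₂ _+_ (sym (∑-permutations (f ∘ (x ∷_)) y ys)) (∑-cong S later≡) ⟩
    ∑[ σ ∈ permutations (y ∷ ys) ] f (x ∷ σ) + ∑[ p ∈ S ] ∑[ τ ∈ permutations (x ∷ proj₂ p) ] f (proj₁ p ∷ τ)
      ≡⟨ cong (∑[ σ ∈ permutations (y ∷ ys) ] f (x ∷ σ) +_) (sym (∑-map _ (map₂ (x ∷_)) S)) ⟩
    ∑[ p ∈ select (x ∷ y ∷ ys) ] ∑[ τ ∈ permutations (proj₂ p) ] f (proj₁ p ∷ τ)
      ∎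
    where
    open ≡-Reasoning
    S = select (y ∷ ys)
    g : List A → ℕ
    g σ = ∑ f (insertEverywhere x σ)
    later : A × List A → ℕ
    later (z , r) = ∑[ τ ∈ permutations r ] ∑ f (map (z ∷_) (insertEverywhere x τ))
    later≡ : ∀ p → later p ≡ ∑[ τ ∈ permutations (x ∷ proj₂ p) ] f (proj₁ p ∷ τ)
    later≡ (z , r) = trans (∑-cong (permutations r) (λ τ → ∑-map f (z ∷_) (insertEverywhere x τ)))
                           (sym (∑-concatMap (f ∘ (z ∷_)) (insertEverywhere x) (permutations r)))

b2n≤1 : ∀ b → b2n b ≤ 1
b2n≤1 false = z≤n
b2n≤1 true  = s≤s z≤n

module _ {n : ℕ} (G : Rel n) where

  free : List (Fin n) → Fin n → Bool
  free C y = not (any (G y) C)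

  step : List (Fin n) → Fin n → List (Fin n)
  step C x = if any (G x) C then C else x ∷ C

  lfmisGo-∷ : ∀ C x σ → lfmisGo G C (x ∷ σ) ≡ lfmisGo G (step C x) σ
  lfmisGo-∷ C x σ with any (G x) C
  ... | true  = refl
  ... | false = refl

  memb-step : ∀ C x v → memb v (step C x) ≡ (⌊ x ≟ v ⌋ ∧ free C x) ∨ memb v C
  memb-step C x v with any (G x) C
  ... | true  = cong (_∨ memb v C) (sym (∧-zeroʳ ⌊ x ≟ v ⌋))
  ... | false = cong (_∨ memb v C) (sym (∧-identityʳ ⌊ x ≟ v ⌋))

  module _ (simple : IsSimple G) where
    open IsSimple simple

    free-step : ∀ C x y → free (step C x) y ≡ not (G x y ∧ free C x) ∧ free C y
    free-step C x y with any (G x) C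
    ... | true  = cong (λ e → not e ∧ free C y) (sym (∧-zeroʳ (G x y)))
    ... | false = begin
      not (G y x ∨ any (G y) C)           ≡⟨ cong (λ e → not (e ∨ any (G y) C)) (symmetric y x) ⟩
      not (G x y ∨ any (G y) C)           ≡⟨ deMorgan₂ (G x y) (any (G y) C) ⟩
      not (G x y) ∧ free C y              ≡⟨ cong (λ e → not e ∧ free C y) (sym (∧-identityʳ (G x y))) ⟩
      not (G x y ∧ true) ∧ free C y       ∎
      where open ≡-Reasoning

    free-step-self : ∀ C x → free (step C x) x ≡ free C x
    free-step-self C x = trans (free-step C x x) (cong (λ e → not (e ∧ free C x) ∧ free C x) (irreflexive x))

symDiffCount : ∀ {n} → List (Fin n) → List (Fin n) → ℕ
symDiffCount {n} C C' = ∑[ v ∈ allFin n ] b2n (memb v C xor memb v C')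

∧-∨-xor-≤ : ∀ e f f' m m' → b2n (((e ∧ f) ∨ m) xor ((e ∧ f') ∨ m')) ≤ b2n (e ∧ (f xor f')) + b2n (m xor m')
∧-∨-xor-≤ false f     f'    m m' = ≤-refl
∧-∨-xor-≤ true  true  true  m m' = z≤n
∧-∨-xor-≤ true  false false m m' = ≤-refl
∧-∨-xor-≤ true  true  false m m' = ≤-trans (b2n≤1 (not m')) (s≤s z≤n)
∧-∨-xor-≤ true  false true  m m' = ≤-trans (b2n≤1 (m xor true)) (s≤s z≤n)

symDiffCount-step : ∀ {n} (G G' : Rel n) C C' x →
  symDiffCount (step G C x) (step G' C' x) ≤ b2n (free G C x xor free G' C' x) + symDiffCount C C'
symDiffCount-step {n} G G' C C' x = begin
  symDiffCount (step G C x) (step G' C' x)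
    ≡⟨ ∑-cong (allFin n) (λ v → cong₂ (λ a b → b2n (a xor b)) (memb-step G C x v) (memb-step G' C' x v)) ⟩
  ∑[ v ∈ allFin n ] b2n (((⌊ x ≟ v ⌋ ∧ f) ∨ memb v C) xor ((⌊ x ≟ v ⌋ ∧ f') ∨ memb v C'))
    ≤⟨ ∑-mono-≤ (allFin n) (λ {v} _ → ∧-∨-xor-≤ ⌊ x ≟ v ⌋ f f' (memb v C) (memb v C')) ⟩
  ∑[ v ∈ allFin n ] (b2n (⌊ x ≟ v ⌋ ∧ (f xor f')) + b2n (memb v C xor memb v C'))
    ≡⟨ ∑-distrib-+ _ _ (allFin n) ⟩
  ∑[ v ∈ allFin n ] b2n (⌊ x ≟ v ⌋ ∧ (f xor f')) + symDiffCount C C'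
    ≡⟨ cong (_+ symDiffCount C C') (∑-indicator x (f xor f')) ⟩
  b2n (f xor f') + symDiffCount C C'
    ∎
  where
  open ≤-Reasoning
  f  = free G C x
  f' = free G' C' x

module _ {n : ℕ} where

  _⊕_ : Rel n → Rel n → Rel n
  (A ⊕ B) i j = A i j xor B i j

  ⊕-isSimple : ∀ {A B : Rel n} → IsSimple A → IsSimple B → IsSimple (A ⊕ B)
  ⊕-isSimple sA sB = record
    { symmetric   = λ i j → cong₂ _xor_ (IsSimple.symmetric sA i j) (IsSimple.symmetric sB i j)
    ; irreflexive = λ i → cong₂ _xor_ (IsSimple.irreflexive sA i) (IsSimple.irreflexive sB i)
    }

  update-isSimple : ∀ {E E₊ E₋ : Rel n} → IsSimple E → IsSimple E₊ → IsSimple E₋ → IsSimple (update E E₊ E₋)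
  update-isSimple {E₋ = E₋} sE sE₊ sE₋ = record
    { symmetric   = λ i j → cong₂ (λ a b → a ∧ not b)
                                  (cong₂ _∨_ (IsSimple.symmetric sE i j) (IsSimple.symmetric sE₊ i j))
                                  (IsSimple.symmetric sE₋ i j)
    ; irreflexive = λ i → cong (λ a → a ∧ not (E₋ i i))
                               (cong₂ _∨_ (IsSimple.irreflexive sE i) (IsSimple.irreflexive sE₊ i))
    }

  edge-split : ∀ {A : Rel n} → IsSimple A → ∀ i j →
    b2n (A i j) ≡ b2n ((toℕ i <ᵇ toℕ j) ∧ A i j) + b2n ((toℕ j <ᵇ toℕ i) ∧ A j i)
  edge-split {A} sA i j with toℕ i <ᵇ toℕ j in i<ᵇj | toℕ j <ᵇ toℕ i in j<ᵇi
  ... | true  | true  = contradiction (<ᵇ⇒< (toℕ i) (toℕ j) (subst T (sym i<ᵇj) _))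
                                      (<⇒≯ (<ᵇ⇒< (toℕ j) (toℕ i) (subst T (sym j<ᵇi) _)))
  ... | true  | false = sym (+-identityʳ (b2n (A i j)))
  ... | false | true  = cong b2n (IsSimple.symmetric sA i j)
  ... | false | false = begin
    b2n (A i j) ≡⟨ cong (λ k → b2n (A i k)) (sym i≡j) ⟩
    b2n (A i i) ≡⟨ cong b2n (IsSimple.irreflexive sA i) ⟩
    0           ∎
    where
    open ≡-Reasoning
    i≡j : i ≡ j
    i≡j = toℕ-injective (≤-antisym (≮⇒≥ (subst T j<ᵇi ∘ <⇒<ᵇ)) (≮⇒≥ (subst T i<ᵇj ∘ <⇒<ᵇ)))

  handshake : ∀ {A : Rel n} → IsSimple A → ∑[ i ∈ allFin n ] ∑[ j ∈ allFin n ] b2n (A i j) ≡ 2 * edgeCount A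
  handshake {A} sA = begin
    ∑[ i ∈ allFin n ] ∑[ j ∈ allFin n ] b2n (A i j)
      ≡⟨ ∑-cong (allFin n) (λ i → ∑-cong (allFin n) (edge-split sA i)) ⟩
    ∑[ i ∈ allFin n ] ∑[ j ∈ allFin n ] (F i j + F j i)
      ≡⟨ sym (∑∑-symmetrise F (allFin n)) ⟩
    2 * edgeCount A
      ∎
    where
    open ≡-Reasoning
    F : Fin n → Fin n → ℕ
    F i j = b2n ((toℕ i <ᵇ toℕ j) ∧ A i j)

  edgeCount-subadditive : ∀ {A B C : Rel n} → (∀ i j → b2n (A i j) ≤ b2n (B i j) + b2n (C i j)) →
    edgeCount A ≤ edgeCount B + edgeCount C
  edgeCount-subadditive {A} {B} {C} A≤B+C = begin
    edgeCount A
      ≤⟨ ∑-mono-≤ (allFin n) (λ {i} _ → ∑-mono-≤ (allFin n) (λ {j} _ → restrict (toℕ i <ᵇ toℕ j) (A≤B+C i j))) ⟩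
    ∑[ i ∈ allFin n ] ∑[ j ∈ allFin n ] (b2n ((toℕ i <ᵇ toℕ j) ∧ B i j) + b2n ((toℕ i <ᵇ toℕ j) ∧ C i j))
      ≡⟨ ∑∑-distrib-+ _ _ (allFin n) (allFin n) ⟩
    edgeCount B + edgeCount C
      ∎
    where
    open ≤-Reasoning
    restrict : ∀ e {a b c} → b2n a ≤ b2n b + b2n c → b2n (e ∧ a) ≤ b2n (e ∧ b) + b2n (e ∧ c)
    restrict false _ = z≤n
    restrict true  a≤b+c = a≤b+c

xor-update-≤ : ∀ e p m → b2n (e xor ((e ∨ p) ∧ not m)) ≤ b2n p + b2n m
xor-update-≤ true  p     true  = m≤n+m 1 (b2n p)
xor-update-≤ true  p     false = z≤n
xor-update-≤ false false m     = z≤n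
xor-update-≤ false true  m     = ≤-trans (b2n≤1 (not m)) (s≤s z≤n)

edgeCount-⊕-update : ∀ {n} (E E₊ E₋ : Rel n) → edgeCount (E ⊕ update E E₊ E₋) ≤ edgeCount E₊ + edgeCount E₋
edgeCount-⊕-update E E₊ E₋ = edgeCount-subadditive (λ i j → xor-update-≤ (E i j) (E₊ i j) (E₋ i j))

-- The coupled scans

b2n≤k+1 : ∀ b k → b2n b ≤ k + 1
b2n≤k+1 b k = ≤-trans (b2n≤1 b) (m≤n+m 1 k)

-- h is the edge xy, p and q the availability of x and y in one scan; primed: in the other.
pair-≤ : ∀ h h' p p' q q' →
  b2n ((not (h ∧ p) ∧ q) xor (not (h' ∧ p') ∧ q')) + b2n ((not (h ∧ q) ∧ p) xor (not (h' ∧ q') ∧ p'))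
    ≤ (b2n (q xor q') + b2n (h xor h')) + (b2n (p xor p') + b2n (h xor h'))
pair-≤ false false p     p'    q     q'    =
  ≤-reflexive (cong₂ _+_ (sym (+-identityʳ (b2n (q xor q')))) (sym (+-identityʳ (b2n (p xor p')))))
pair-≤ false true  p     p'    q     q'    =
  +-mono-≤ (b2n≤k+1 (q xor (not p' ∧ q')) (b2n (q xor q'))) (b2n≤k+1 (p xor (not q' ∧ p')) (b2n (p xor p')))
pair-≤ true  false p     p'    q     q'    =
  +-mono-≤ (b2n≤k+1 ((not p ∧ q) xor q') (b2n (q xor q'))) (b2n≤k+1 ((not q ∧ p) xor p') (b2n (p xor p')))
pair-≤ true  true  false false false false = ≤ᵇ⇒≤ _ _ _
pair-≤ true  true  false false false true  = ≤ᵇ⇒≤ _ _ _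
pair-≤ true  true  false false true  false = ≤ᵇ⇒≤ _ _ _
pair-≤ true  true  false false true  true  = ≤ᵇ⇒≤ _ _ _
pair-≤ true  true  false true  false false = ≤ᵇ⇒≤ _ _ _
pair-≤ true  true  false true  false true  = ≤ᵇ⇒≤ _ _ _
pair-≤ true  true  false true  true  false = ≤ᵇ⇒≤ _ _ _
pair-≤ true  true  false true  true  true  = ≤ᵇ⇒≤ _ _ _
pair-≤ true  true  true  false false false = ≤ᵇ⇒≤ _ _ _
pair-≤ true  true  true  false false true  = ≤ᵇ⇒≤ _ _ _
pair-≤ true  true  true  false true  false = ≤ᵇ⇒≤ _ _ _
pair-≤ true  true  true  false true  true  = ≤ᵇ⇒≤ _ _ _
pair-≤ true  true  true  true  false false = ≤ᵇ⇒≤ _ _ _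
pair-≤ true  true  true  true  false true  = ≤ᵇ⇒≤ _ _ _
pair-≤ true  true  true  true  true  false = ≤ᵇ⇒≤ _ _ _
pair-≤ true  true  true  true  true  true  = ≤ᵇ⇒≤ _ _ _

module Coupling {n : ℕ} {H H' : Rel n} (simpleH : IsSimple H) (simpleH' : IsSimple H') where

  freeMismatch : List (Fin n) → List (Fin n) → Fin n → ℕ
  freeMismatch C C' y = b2n (free H C y xor free H' C' y)

  freeMismatchAfter : List (Fin n) → List (Fin n) → Fin n → Fin n → ℕ
  freeMismatchAfter C C' x = freeMismatch (step H C x) (step H' C' x)

  edgeMismatch : Fin n → Fin n → ℕ
  edgeMismatch x y = b2n ((H ⊕ H') x y)

  -- C and C' are the vertices chosen so far by the scans of H and H', L those not yet scanned.
  potential : List (Fin n) → List (Fin n) → List (Fin n) → ℕ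
  potential C C' L =
    2 * symDiffCount C C' + 2 * ∑ (freeMismatch C C') L + ∑[ x ∈ L ] ∑[ y ∈ L ] edgeMismatch x y

  recourseSum : List (Fin n) → List (Fin n) → List (Fin n) → ℕ
  recourseSum C C' L = ∑[ σ ∈ permutations L ] symDiffCount (lfmisGo H C σ) (lfmisGo H' C' σ)

  edgeMismatch-sym : ∀ x y → edgeMismatch x y ≡ edgeMismatch y x
  edgeMismatch-sym x y = cong b2n (IsSimple.symmetric (⊕-isSimple simpleH simpleH') x y)

  edgeMismatch-diag : ∀ x → edgeMismatch x x ≡ 0
  edgeMismatch-diag x = cong b2n (IsSimple.irreflexive (⊕-isSimple simpleH simpleH') x)

  freeMismatchAfter-self : ∀ C C' x → freeMismatchAfter C C' x x ≡ freeMismatch C C' x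
  freeMismatchAfter-self C C' x =
    cong₂ (λ a b → b2n (a xor b)) (free-step-self H simpleH C x) (free-step-self H' simpleH' C' x)

  freeMismatchAfter-pair : ∀ C C' x y →
    freeMismatchAfter C C' x y + freeMismatchAfter C C' y x
      ≤ (freeMismatch C C' y + edgeMismatch x y) + (freeMismatch C C' x + edgeMismatch y x)
  freeMismatchAfter-pair C C' x y
    rewrite free-step H simpleH C x y | free-step H' simpleH' C' x y
          | free-step H simpleH C y x | free-step H' simpleH' C' y x
          | IsSimple.symmetric simpleH y x | IsSimple.symmetric simpleH' y x
    = pair-≤ (H x y) (H' x y) (free H C x) (free H' C' x) (free H C y) (free H' C' y)

  ∑∑-freeMismatchAfter : ∀ C C' L →
    ∑[ x ∈ L ] ∑[ y ∈ L ] freeMismatchAfter C C' x y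
      ≤ length L * ∑ (freeMismatch C C') L + ∑[ x ∈ L ] ∑[ y ∈ L ] edgeMismatch x y
  ∑∑-freeMismatchAfter C C' L = begin
    ∑[ x ∈ L ] ∑[ y ∈ L ] freeMismatchAfter C C' x y
      ≤⟨ ∑∑-mono-≤-symmetrised L (freeMismatchAfter-pair C C') ⟩
    ∑[ x ∈ L ] ∑[ y ∈ L ] (freeMismatch C C' y + edgeMismatch x y)
      ≡⟨ ∑∑-distrib-+ (λ _ y → freeMismatch C C' y) edgeMismatch L L ⟩
    ∑[ x ∈ L ] ∑ (freeMismatch C C') L + ∑[ x ∈ L ] ∑[ y ∈ L ] edgeMismatch x y
      ≡⟨ cong (_+ ∑[ x ∈ L ] ∑[ y ∈ L ] edgeMismatch x y) (∑-const (∑ (freeMismatch C C') L) L) ⟩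
    length L * ∑ (freeMismatch C C') L + ∑[ x ∈ L ] ∑[ y ∈ L ] edgeMismatch x y
      ∎
    where open ≤-Reasoning

  potential-step-≤ : ∀ C C' {x r L} → x ∷ r ↭ L →
    potential (step H C x) (step H' C' x) r + 2 * ∑ (edgeMismatch x) L
      ≤ 2 * symDiffCount C C' + 2 * ∑ (freeMismatchAfter C C' x) L + ∑[ a ∈ L ] ∑[ b ∈ L ] edgeMismatch a b
  potential-step-≤ C C' {x} {r} {L} x∷r↭L = begin
    2 * symDiffCount (step H C x) (step H' C' x) + 2 * ∑ ψ r + δr + 2 * ∑ (edgeMismatch x) L
      ≤⟨ +-monoˡ-≤ _ (+-monoˡ-≤ _ (+-monoˡ-≤ _ (*-monoʳ-≤ 2 (symDiffCount-step H H' C C' x)))) ⟩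
    2 * (freeMismatch C C' x + m) + 2 * ∑ ψ r + δr + 2 * ∑ (edgeMismatch x) L
      ≡⟨ regroup (freeMismatch C C' x) m (∑ ψ r) δr (∑ (edgeMismatch x) L) ⟩
    2 * m + 2 * (freeMismatch C C' x + ∑ ψ r) + (δr + 2 * ∑ (edgeMismatch x) L)
      ≡⟨ cong₂ (λ a b → 2 * m + 2 * a + b) ψ-sum (sym (∑∑-remove edgeMismatch-sym edgeMismatch-diag x∷r↭L)) ⟩
    2 * m + 2 * ∑ ψ L + ∑[ a ∈ L ] ∑[ b ∈ L ] edgeMismatch a b
      ∎
    where
    open ≤-Reasoning
    m  = symDiffCount C C'
    ψ  = freeMismatchAfter C C' x
    δr = ∑[ a ∈ r ] ∑[ b ∈ r ] edgeMismatch a b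
    ψ-sum : freeMismatch C C' x + ∑ ψ r ≡ ∑ ψ L
    ψ-sum = trans (cong (_+ ∑ ψ r) (sym (freeMismatchAfter-self C C' x))) (∑-↭ ψ x∷r↭L)
    regroup : ∀ c m s t d → 2 * (c + m) + 2 * s + t + 2 * d ≡ 2 * m + 2 * (c + s) + (t + 2 * d)
    regroup = solve-∀

  ∑-potential-step-≤ : ∀ C C' L →
    ∑[ p ∈ select L ] potential (step H C (proj₁ p)) (step H' C' (proj₁ p)) (proj₂ p) ≤ length L * potential C C' L
  ∑-potential-step-≤ C C' L = +-cancelʳ-≤ (2 * δL) _ _ (begin
    ∑ Φ′ S + 2 * δL
      ≡⟨ cong (λ z → ∑ Φ′ S + 2 * z) (sym (∑-select (λ x → ∑ (edgeMismatch x) L) L)) ⟩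
    ∑ Φ′ S + 2 * ∑[ p ∈ S ] ∑ (edgeMismatch (proj₁ p)) L
      ≡⟨ cong (∑ Φ′ S +_) (*-distribˡ-∑ 2 _ S) ⟩
    ∑ Φ′ S + ∑[ p ∈ S ] (2 * ∑ (edgeMismatch (proj₁ p)) L)
      ≡⟨ sym (∑-distrib-+ Φ′ _ S) ⟩
    ∑[ p ∈ S ] (Φ′ p + 2 * ∑ (edgeMismatch (proj₁ p)) L)
      ≤⟨ ∑-mono-≤ S (λ p∈S → potential-step-≤ C C' (select-↭ L p∈S)) ⟩
    ∑[ p ∈ S ] bound (proj₁ p)
      ≡⟨ ∑-select bound L ⟩
    ∑ bound L
      ≡⟨ ∑-distrib-+ _ _ L ⟩
    ∑[ x ∈ L ] (2 * m + 2 * ∑ (freeMismatchAfter C C' x) L) + ∑[ x ∈ L ] δL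
      ≡⟨ cong₂ _+_ (∑-distrib-+ _ _ L) (∑-const δL L) ⟩
    ∑[ x ∈ L ] (2 * m) + ∑[ x ∈ L ] (2 * ∑ (freeMismatchAfter C C' x) L) + l * δL
      ≡⟨ cong₂ (λ a b → a + b + l * δL) (∑-const (2 * m) L) (sym (*-distribˡ-∑ 2 _ L)) ⟩
    l * (2 * m) + 2 * ∑[ x ∈ L ] ∑[ y ∈ L ] freeMismatchAfter C C' x y + l * δL
      ≤⟨ +-monoˡ-≤ _ (+-monoʳ-≤ (l * (2 * m)) (*-monoʳ-≤ 2 (∑∑-freeMismatchAfter C C' L))) ⟩
    l * (2 * m) + 2 * (l * c + δL) + l * δL
      ≡⟨ regroup l m c δL ⟩
    l * potential C C' L + 2 * δL
      ∎)
    where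
    open ≤-Reasoning
    S  = select L
    l  = length L
    m  = symDiffCount C C'
    c  = ∑ (freeMismatch C C') L
    δL = ∑[ a ∈ L ] ∑[ b ∈ L ] edgeMismatch a b
    Φ′ : Fin n × List (Fin n) → ℕ
    Φ′ p = potential (step H C (proj₁ p)) (step H' C' (proj₁ p)) (proj₂ p)
    bound : Fin n → ℕ
    bound x = 2 * m + 2 * ∑ (freeMismatchAfter C C' x) L + δL
    regroup : ∀ l m c d → l * (2 * m) + 2 * (l * c + d) + l * d ≡ l * (2 * m + 2 * c + d) + 2 * d
    regroup = solve-∀

  recourseSum-by-head : ∀ C C' x xs →
    recourseSum C C' (x ∷ xs)
      ≡ ∑[ p ∈ select (x ∷ xs) ] recourseSum (step H C (proj₁ p)) (step H' C' (proj₁ p)) (proj₂ p)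
  recourseSum-by-head C C' x xs =
    trans (∑-permutations _ x xs)
          (∑-cong (select (x ∷ xs)) (λ p → ∑-cong (permutations (proj₂ p)) (λ τ →
            cong₂ symDiffCount (lfmisGo-∷ H C (proj₁ p) τ) (lfmisGo-∷ H' C' (proj₁ p) τ))))

  recourseSum-≤-potential : ∀ k L → length L ≡ k → ∀ C C' → 2 * recourseSum C C' L ≤ k ! * potential C C' L
  recourseSum-≤-potential zero    []       _   C C' = ≤-reflexive (base (symDiffCount C C'))
    where
    base : ∀ m → 2 * (m + 0) ≡ 1 * (2 * m + 2 * 0 + 0)
    base = solve-∀
  recourseSum-≤-potential (suc k) (x ∷ xs) len C C' = begin
    2 * recourseSum C C' (x ∷ xs)     ≡⟨ cong (2 *_) (recourseSum-by-head C C' x xs) ⟩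
    2 * ∑ R′ S                        ≡⟨ *-distribˡ-∑ 2 R′ S ⟩
    ∑[ p ∈ S ] (2 * R′ p)             ≤⟨ ∑-mono-≤ S (λ {p} p∈S → induction p (remainder-length p∈S)) ⟩
    ∑[ p ∈ S ] (k ! * Φ′ p)           ≡⟨ sym (*-distribˡ-∑ (k !) Φ′ S) ⟩
    k ! * ∑ Φ′ S                      ≤⟨ *-monoʳ-≤ (k !) (∑-potential-step-≤ C C' (x ∷ xs)) ⟩
    k ! * (length (x ∷ xs) * Φ)       ≡⟨ cong (λ l → k ! * (l * Φ)) len ⟩
    k ! * (suc k * Φ)                 ≡⟨ trans (sym (*-assoc (k !) (suc k) Φ)) (cong (_* Φ) (*-comm (k !) (suc k))) ⟩
    suc k ! * Φ                       ∎
    where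
    open ≤-Reasoning
    S = select (x ∷ xs)
    Φ = potential C C' (x ∷ xs)
    R′ Φ′ : Fin n × List (Fin n) → ℕ
    R′ p = recourseSum (step H C (proj₁ p)) (step H' C' (proj₁ p)) (proj₂ p)
    Φ′ p = potential (step H C (proj₁ p)) (step H' C' (proj₁ p)) (proj₂ p)
    induction : ∀ p → length (proj₂ p) ≡ k → 2 * R′ p ≤ k ! * Φ′ p
    induction p len′ = recourseSum-≤-potential k (proj₂ p) len′ (step H C (proj₁ p)) (step H' C' (proj₁ p))
    remainder-length : ∀ {p} → p ∈ S → length (proj₂ p) ≡ k
    remainder-length p∈S = suc-injective (trans (↭-length (select-↭ (x ∷ xs) p∈S)) len)

  initial-potential : potential [] [] (allFin n) ≡ 2 * edgeCount (H ⊕ H')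
  initial-potential = begin
    2 * symDiffCount {n} [] [] + 2 * ∑ (freeMismatch [] []) V + δV ≡⟨ cong₂ (λ a b → 2 * a + 2 * b + δV) (∑-zero V) (∑-zero V) ⟩
    δV                                                            ≡⟨ handshake (⊕-isSimple simpleH simpleH') ⟩
    2 * edgeCount (H ⊕ H')                                        ∎
    where
    open ≡-Reasoning
    V  = allFin n
    δV = ∑[ x ∈ V ] ∑[ y ∈ V ] edgeMismatch x y

recourse-≤-edgeCount-⊕ : ∀ {n} {H H' : Rel n} → IsSimple H → IsSimple H' →
  sumOverOrderings n (symDiffSize H H') ≤ edgeCount (H ⊕ H') * n !
recourse-≤-edgeCount-⊕ {n} {H} {H'} simpleH simpleH' = *-cancelˡ-≤ 2 (begin
  2 * recourseSum [] [] (allFin n)      ≤⟨ recourseSum-≤-potential n (allFin n) (length-tabulate id) [] [] ⟩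
  n ! * potential [] [] (allFin n)      ≡⟨ cong (n ! *_) initial-potential ⟩
  n ! * (2 * edgeCount (H ⊕ H'))        ≡⟨ rearrange (n !) (edgeCount (H ⊕ H')) ⟩
  2 * (edgeCount (H ⊕ H') * n !)        ∎)
  where
  open Coupling simpleH simpleH'
  open ≤-Reasoning
  rearrange : ∀ f e → f * (2 * e) ≡ 2 * (e * f)
  rearrange = solve-∀

mainTheorem4 : (n : ℕ) (E E₊ E₋ : Rel n) →
    IsSimple E → IsSimple E₊ → IsSimple E₋ →
    (b : ℕ) → edgeCount E₊ + edgeCount E₋ ≡ b →
    sumOverOrderings n (symDiffSize E (update E E₊ E₋)) ≤ b * (n !)
mainTheorem4 n E E₊ E₋ simpleE simpleE₊ simpleE₋ b refl = begin
  sumOverOrderings n (symDiffSize E (update E E₊ E₋))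
    ≤⟨ recourse-≤-edgeCount-⊕ simpleE (update-isSimple simpleE simpleE₊ simpleE₋) ⟩
  edgeCount (E ⊕ update E E₊ E₋) * n !
    ≤⟨ *-monoˡ-≤ (n !) (edgeCount-⊕-update E E₊ E₋) ⟩
  (edgeCount E₊ + edgeCount E₋) * n !
    ∎
  where open ≤-Reasoning
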